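{- Let $n$ be a natural number and let $0\leq a_1<\dots<a_k\leq n$ and $0\leq b_1<\dots<b_m\leq n$ be integers such that \[\binom{n}{a_1}+\dots+\binom{n}{a_k}\leq\binom{n}{b_1}+\dots+\binom{n}{b_m}.\] Set $\Sigma:=\{S\subseteq[n]\,:\,|S|\in\{a_1,\dots,a_k\}\}$ and $\Lambda:=\{T\subseteq[n]\,:\,|T|\in\{b_1,\dots,b_m\}\}$. Then there exists an injection $\Phi:\Sigma\to\Lambda$ such that for every $S\in\Sigma$ we have $S\subseteq\Phi(S)$ or $S\supseteq\Phi(S)$.
   Context: $[n]:=\{1,\dots,n\}$. -}

module Defs where

open import Data.Nat using (ℕ; _+_; _<_; _≤_)
open import Data.Fin using (Fin; zero; suc)
open import Data.Fin.Subset using (Subset; ∣_∣)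
open import Data.Product using (∃)
open import Relation.Binary.PropositionalEquality using (_≡_)

∑ : (k : ℕ) → (Fin k → ℕ) → ℕ
∑ ℕ.zero f = 0
∑ (ℕ.suc k) f = f zero + ∑ k (λ i → f (suc i))

StrictlyIncreasing : {k : ℕ} → (Fin k → ℕ) → Set
StrictlyIncreasing {k} a = ∀ (i j : Fin k) → Data.Fin._<_ i j → a i < a j

BoundedBy : {k : ℕ} → ℕ → (Fin k → ℕ) → Set
BoundedBy {k} n a = ∀ (i : Fin k) → a i ≤ n

HasSizeIn : {n k : ℕ} → (Fin k → ℕ) → Subset n → Set
HasSizeIn {n} {k} a S = ∃ λ (i : Fin k) → ∣ S ∣ ≡ a i

-- Let the subsets of [n], numbered by Fin (2 ^ n), form a bipartite graph in which S and T are
-- adjacent when they are comparable. Φ is a matching of Σ into Λ in this graph, so by Hall's theorem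
-- it suffices that |Γ X ∩ Λ| ≥ |X| for every X ⊆ Σ. Between two levels α and β the graph is
-- biregular, so double counting gives the normalized matching property
-- |Y| / C(n,α) ≤ |Γ Y ∩ level β| / C(n,β) for Y ⊆ level α. If a_t is the level in which X is
-- densest relative to C(n,a_t), then, with Y = X ∩ level a_t,
--   |X| ≤ |Y| ∑ C(n,a) / C(n,a_t) ≤ |Y| ∑ C(n,b) / C(n,a_t) ≤ ∑_s |Γ Y ∩ level b_s| ≤ |Γ X ∩ Λ|.

module Submission where

open import Defs
open import Algebra using (CommutativeMonoid)
open import Data.Bool using (Bool; true; false; _∧_; _∨_; not; if_then_else_; T)
import Data.Bool.Properties as Boolₚ
open import Data.Empty using (⊥-elim)
open import Data.Fin using (Fin; zero; suc; _↑ˡ_; _↑ʳ_; splitAt; join)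
open import Data.Fin.Properties
  using (all?; splitAt-↑ˡ; splitAt-↑ʳ; join-splitAt) renaming (_≟_ to _≟ᶠ_; <-cmp to <-cmpᶠ)
open import Data.Fin.Subset using (Subset; ∣_∣; _⊆_; ∁; ⊥)
open import Data.Fin.Subset.Properties using (anySubset?; p⊆q⇒∣p∣≤∣q∣; ∣∁p∣≡n∸∣p∣)
open import Data.Nat
open import Data.Nat.Combinatorics using (_C_; nCk+nC[k+1]≡[n+1]C[k+1])
open import Data.Nat.Properties
open import Data.Product using (Σ; ∃; _×_; _,_; proj₁; proj₂)
open import Data.Sum using (_⊎_; inj₁; inj₂; [_,_]′)
open import Data.Vec using ([]; _∷_; here; there; lookup; tabulate)
open import Data.Vec.Properties using (lookup∘tabulate)
open import Function.Definitions using (Injective)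
open import Relation.Binary.Definitions using (tri<; tri≈; tri>)
open import Relation.Binary.PropositionalEquality
open import Relation.Nullary using (Dec; yes; no; does; ¬_)
open import Relation.Nullary.Decidable using (_×-dec_; _→-dec_)

import Algebra.Properties.CommutativeSemigroup as CommSemigroupₚ
module +ₚ = CommSemigroupₚ +-commutativeSemigroup
module *ₚ = CommSemigroupₚ *-commutativeSemigroup
module ∨ₚ = CommSemigroupₚ (CommutativeMonoid.commutativeSemigroup Boolₚ.∨-commutativeMonoid)

∑-cong : ∀ k {f g : Fin k → ℕ} → (∀ i → f i ≡ g i) → ∑ k f ≡ ∑ k g
∑-cong zero    f≡g = refl
∑-cong (suc k) f≡g = cong₂ _+_ (f≡g zero) (∑-cong k (λ i → f≡g (suc i)))

∑-mono-≤ : ∀ k {f g : Fin k → ℕ} → (∀ i → f i ≤ g i) → ∑ k f ≤ ∑ k g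
∑-mono-≤ zero    f≤g = z≤n
∑-mono-≤ (suc k) f≤g = +-mono-≤ (f≤g zero) (∑-mono-≤ k (λ i → f≤g (suc i)))

∑-zero : ∀ k → ∑ k (λ _ → 0) ≡ 0
∑-zero zero    = refl
∑-zero (suc k) = ∑-zero k

∑-distrib-+ : ∀ k (f g : Fin k → ℕ) → ∑ k (λ i → f i + g i) ≡ ∑ k f + ∑ k g
∑-distrib-+ zero    f g = refl
∑-distrib-+ (suc k) f g =
  trans (cong ((f zero + g zero) +_) (∑-distrib-+ k (λ i → f (suc i)) (λ i → g (suc i))))
        (+ₚ.interchange (f zero) (g zero) _ _)

*-distribˡ-∑ : ∀ k c (f : Fin k → ℕ) → c * ∑ k f ≡ ∑ k (λ i → c * f i)
*-distribˡ-∑ zero    c f = *-zeroʳ c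
*-distribˡ-∑ (suc k) c f =
  trans (*-distribˡ-+ c (f zero) _) (cong (c * f zero +_) (*-distribˡ-∑ k c (λ i → f (suc i))))

*-distribʳ-∑ : ∀ k c (f : Fin k → ℕ) → ∑ k f * c ≡ ∑ k (λ i → f i * c)
*-distribʳ-∑ k c f =
  trans (*-comm (∑ k f) c) (trans (*-distribˡ-∑ k c f) (∑-cong k (λ i → *-comm c (f i))))

∑-comm : ∀ k l (h : Fin k → Fin l → ℕ) →
         ∑ k (λ i → ∑ l (h i)) ≡ ∑ l (λ j → ∑ k (λ i → h i j))
∑-comm zero    l h = sym (∑-zero l)
∑-comm (suc k) l h =
  trans (cong (∑ l (h zero) +_) (∑-comm k l (λ i → h (suc i))))
        (sym (∑-distrib-+ l (h zero) (λ j → ∑ k (λ i → h (suc i) j))))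

∑-++ : ∀ k l (f : Fin (k + l) → ℕ) →
       ∑ (k + l) f ≡ ∑ k (λ i → f (i ↑ˡ l)) + ∑ l (λ j → f (k ↑ʳ j))
∑-++ zero    l f = refl
∑-++ (suc k) l f =
  trans (cong (f zero +_) (∑-++ k l (λ i → f (suc i)))) (sym (+-assoc (f zero) _ _))

indicator : Bool → ℕ
indicator b = if b then 1 else 0

infixl 7 _∩_
infixl 6 _∪_ _∖_

_∩_ _∪_ _∖_ : ∀ {k} → (Fin k → Bool) → (Fin k → Bool) → Fin k → Bool
(X ∩ Y) i = X i ∧ Y i
(X ∪ Y) i = X i ∨ Y i
(X ∖ Y) i = X i ∧ not (Y i)

count : ∀ k → (Fin k → Bool) → ℕ
count k X = ∑ k (λ i → indicator (X i))

infix 4 _⊑_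
_⊑_ : ∀ {k} → (Fin k → Bool) → (Fin k → Bool) → Set
X ⊑ Y = ∀ i → X i ≡ true → Y i ≡ true

⁅_⁆ : ∀ {k} → Fin k → Fin k → Bool
⁅ i ⁆ j = does (i ≟ᶠ j)

∈⁅⁆⇒≡ : ∀ {k} (i {j} : Fin k) → ⁅ i ⁆ j ≡ true → i ≡ j
∈⁅⁆⇒≡ i {j} i∈ with i ≟ᶠ j
... | yes i≡j = i≡j

∈⁅_⁆ : ∀ {k} (i : Fin k) → ⁅ i ⁆ i ≡ true
∈⁅ i ⁆ with i ≟ᶠ i
... | yes _  = refl
... | no i≢i = ⊥-elim (i≢i refl)

⁅_⁆⊑ : ∀ {k} (i : Fin k) {X} → X i ≡ true → ⁅ i ⁆ ⊑ X
⁅ i ⁆⊑ {X} Xi j i≡j = subst (λ j′ → X j′ ≡ true) (∈⁅⁆⇒≡ i i≡j) Xi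

∧-true⁻ : ∀ {x y} → x ∧ y ≡ true → x ≡ true × y ≡ true
∧-true⁻ {true} {true} _ = refl , refl

∧-true⁺ : ∀ {x y} → x ≡ true → y ≡ true → x ∧ y ≡ true
∧-true⁺ refl refl = refl

true⇒not≢true : ∀ {x} → x ≡ true → not x ≢ true
true⇒not≢true refl ()

count-cong : ∀ k {X Y : Fin k → Bool} → (∀ i → X i ≡ Y i) → count k X ≡ count k Y
count-cong k X≡Y = ∑-cong k (λ i → cong indicator (X≡Y i))

count-mono : ∀ k {X Y : Fin k → Bool} → X ⊑ Y → count k X ≤ count k Y
count-mono k X⊑Y = ∑-mono-≤ k (λ i → indicator-mono (X⊑Y i))
  where
  indicator-mono : ∀ {x y} → (x ≡ true → y ≡ true) → indicator x ≤ indicator y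
  indicator-mono {false} _   = z≤n
  indicator-mono {true}  x⇒y rewrite x⇒y refl = ≤-refl

count-split : ∀ k (X Y : Fin k → Bool) → count k X ≡ count k (X ∩ Y) + count k (X ∖ Y)
count-split k X Y =
  trans (∑-cong k (λ i → indicator-split (X i) (Y i)))
        (∑-distrib-+ k (λ i → indicator (X i ∧ Y i)) (λ i → indicator (X i ∧ not (Y i))))
  where
  indicator-split : ∀ x y → indicator x ≡ indicator (x ∧ y) + indicator (x ∧ not y)
  indicator-split true  true  = refl
  indicator-split true  false = refl
  indicator-split false y     = refl

count≡0⇒false : ∀ k (X : Fin k → Bool) → count k X ≡ 0 → ∀ i → X i ≡ false
count≡0⇒false (suc k) X ≡0 i with X zero in eq
count≡0⇒false (suc k) X () i       | true
count≡0⇒false (suc k) X ≡0 zero    | false = eq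
count≡0⇒false (suc k) X ≡0 (suc i) | false = count≡0⇒false k (λ i → X (suc i)) ≡0 i

count>0⇒∃ : ∀ k (X : Fin k → Bool) → 0 < count k X → ∃ λ i → X i ≡ true
count>0⇒∃ (suc k) X >0 with X zero in eq
... | true  = zero , eq
... | false with count>0⇒∃ k (λ i → X (suc i)) >0
...   | i , Xi = suc i , Xi

count-⁅⁆ : ∀ k (i : Fin k) → count k ⁅ i ⁆ ≡ 1
count-⁅⁆ (suc k) zero    = cong suc (∑-zero k)
count-⁅⁆ (suc k) (suc i) = count-⁅⁆ k i

any : ∀ k → (Fin k → Bool) → Bool
any zero    X = false
any (suc k) X = X zero ∨ any k (λ i → X (suc i))

any⁻ : ∀ k (X : Fin k → Bool) → any k X ≡ true → ∃ λ i → X i ≡ true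
any⁻ (suc k) X any≡ with X zero in eq
... | true  = zero , eq
... | false with any⁻ k (λ i → X (suc i)) any≡
...   | i , Xi = suc i , Xi

any⁺ : ∀ k (X : Fin k → Bool) i → X i ≡ true → any k X ≡ true
any⁺ (suc k) X zero    Xi rewrite Xi = refl
any⁺ (suc k) X (suc i) Xi
  rewrite any⁺ k (λ i → X (suc i)) i Xi = Boolₚ.∨-zeroʳ (X zero)

any-cong : ∀ k {X Y : Fin k → Bool} → (∀ i → X i ≡ Y i) → any k X ≡ any k Y
any-cong zero    X≡Y = refl
any-cong (suc k) X≡Y = cong₂ _∨_ (X≡Y zero) (any-cong k (λ i → X≡Y (suc i)))

any-mono : ∀ k {X Y : Fin k → Bool} → X ⊑ Y → any k X ≡ true → any k Y ≡ true
any-mono k {X} {Y} X⊑Y anyX with any⁻ k X anyX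
... | i , Xi = any⁺ k Y i (X⊑Y i Xi)

any-false : ∀ k (X : Fin k → Bool) → any k X ≡ false → ∀ i → X i ≡ false
any-false k X anyX≡false i with X i in Xi
... | false = refl
... | true  = trans (sym (any⁺ k X i Xi)) anyX≡false

any-∨ : ∀ k (X Y : Fin k → Bool) → any k (λ i → X i ∨ Y i) ≡ any k X ∨ any k Y
any-∨ zero    X Y = refl
any-∨ (suc k) X Y =
  trans (cong ((X zero ∨ Y zero) ∨_) (any-∨ k (λ i → X (suc i)) (λ i → Y (suc i))))
        (∨ₚ.interchange (X zero) (Y zero) _ _)

count-⊑-split : ∀ k {X L : Fin k → Bool} → X ⊑ L → count k L ≡ count k X + count k (L ∖ X)
count-⊑-split k {X} {L} X⊑L =
  trans (count-split k L X) (cong (_+ count k (L ∖ X)) (count-cong k (λ i → ∧-sub (X⊑L i))))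
  where
  ∧-sub : ∀ {l x} → (x ≡ true → l ≡ true) → l ∧ x ≡ x
  ∧-sub {l} {false} _   = Boolₚ.∧-zeroʳ l
  ∧-sub {l} {true}  x⇒l rewrite x⇒l refl = refl

count-∖⁅⁆ : ∀ k {X : Fin k → Bool} {i} → X i ≡ true → count k X ≡ suc (count k (X ∖ ⁅ i ⁆))
count-∖⁅⁆ k {X} {i} Xi = trans (count-⊑-split k (⁅ i ⁆⊑ Xi)) (cong (_+ count k (X ∖ ⁅ i ⁆)) (count-⁅⁆ k i))

≡ᵇ-true⁻ : ∀ {m n} → (m ≡ᵇ n) ≡ true → m ≡ n
≡ᵇ-true⁻ {m} {n} m≡ᵇn = ≡ᵇ⇒≡ m n (subst T (sym m≡ᵇn) _)

≡ᵇ-true⁺ : ∀ {m n} → m ≡ n → (m ≡ᵇ n) ≡ true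
≡ᵇ-true⁺ {m} {n} m≡n with m ≡ᵇ n | ≡⇒≡ᵇ m n m≡n
... | true | _ = refl

≡ᵇ-false⁺ : ∀ {m n} → m ≢ n → (m ≡ᵇ n) ≡ false
≡ᵇ-false⁺ {m} {n} m≢n with m ≡ᵇ n in m≡ᵇn
... | false = refl
... | true  = ⊥-elim (m≢n (≡ᵇ-true⁻ m≡ᵇn))

≤ᵇ-true⁻ : ∀ {m n} → (m ≤ᵇ n) ≡ true → m ≤ n
≤ᵇ-true⁻ {m} {n} m≤ᵇn = ≤ᵇ⇒≤ m n (subst T (sym m≤ᵇn) _)

≤ᵇ-false⁻ : ∀ {m n} → (m ≤ᵇ n) ≡ false → n < m
≤ᵇ-false⁻ {m} {n} m≰ᵇn = ≰⇒> (λ m≤n → subst T m≰ᵇn (≤⇒≤ᵇ m≤n))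

∧-cong-guard : ∀ {x y z} → (x ≡ true → y ≡ z) → x ∧ y ≡ x ∧ z
∧-cong-guard {false} _   = refl
∧-cong-guard {true}  y≡z = y≡z refl

level : ∀ {p} → (Fin p → ℕ) → ℕ → Fin p → Bool
level rank c i = rank i ≡ᵇ c

levels : ∀ {p k} → (Fin p → ℕ) → (Fin k → ℕ) → Fin p → Bool
levels {k = k} rank a i = any k (λ t → level rank (a t) i)

levels⁺ : ∀ {p k} (rank : Fin p → ℕ) (a : Fin k → ℕ) {i} t → rank i ≡ a t → levels rank a i ≡ true
levels⁺ {k = k} rank a {i} t rank≡a = any⁺ k (λ t → level rank (a t) i) t (≡ᵇ-true⁺ rank≡a)

levels⁻ : ∀ {p k} (rank : Fin p → ℕ) (a : Fin k → ℕ) {i} → levels rank a i ≡ true →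
          ∃ λ t → rank i ≡ a t
levels⁻ {k = k} rank a {i} i∈ = let t , rank≡ᵇa = any⁻ k (λ t → level rank (a t) i) i∈
                                in t , ≡ᵇ-true⁻ rank≡ᵇa

count-levels : ∀ {p k} (rank : Fin p → ℕ) (a : Fin k → ℕ) → Injective _≡_ _≡_ a →
               ∀ X → X ⊑ levels rank a → count p X ≡ ∑ k (λ t → count p (X ∩ level rank (a t)))
count-levels {p} {k} rank a a-injective X X⊑levels =
  trans (∑-cong p single-level) (∑-comm p k (λ i t → indicator (X i ∧ level rank (a t) i)))
  where
  single-level : ∀ i → indicator (X i) ≡ ∑ k (λ t → indicator (X i ∧ level rank (a t) i))
  single-level i with X i in Xi
  ... | false = sym (∑-zero k)
  ... | true  = let t₀ , rank≡at₀ = levels⁻ rank a (X⊑levels i Xi)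
                in sym (trans (count-cong k (level≡⁅⁆ t₀ rank≡at₀)) (count-⁅⁆ k t₀))
    where
    level≡⁅⁆ : ∀ t₀ → rank i ≡ a t₀ → ∀ t → level rank (a t) i ≡ ⁅ t₀ ⁆ t
    level≡⁅⁆ t₀ rank≡at₀ t with t₀ ≟ᶠ t
    ... | yes refl = ≡ᵇ-true⁺ rank≡at₀
    ... | no  t₀≢t = ≡ᵇ-false⁺ (λ rank≡at → t₀≢t (a-injective (trans (sym rank≡at₀) rank≡at)))

-- x₁ / c₁ ≤ x₂ / c₂ ≤ x₃ / c₃ ⇒ x₁ / c₁ ≤ x₃ / c₃, with the denominators cleared.
ratio-≤-trans : ∀ x₁ c₁ x₂ c₂ x₃ c₃ .{{_ : NonZero c₂}} →
                x₁ * c₂ ≤ x₂ * c₁ → x₂ * c₃ ≤ x₃ * c₂ → x₁ * c₃ ≤ x₃ * c₁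
ratio-≤-trans x₁ c₁ x₂ c₂ x₃ c₃ x₁c₂≤x₂c₁ x₂c₃≤x₃c₂ = *-cancelʳ-≤ _ _ c₂ (begin
  x₁ * c₃ * c₂   ≡⟨ *ₚ.xy∙z≈y∙xz x₁ c₃ c₂ ⟩
  c₃ * (x₁ * c₂) ≤⟨ *-monoʳ-≤ c₃ x₁c₂≤x₂c₁ ⟩
  c₃ * (x₂ * c₁) ≡⟨ *ₚ.x∙yz≈yx∙z c₃ x₂ c₁ ⟩
  x₂ * c₃ * c₁   ≤⟨ *-monoˡ-≤ c₁ x₂c₃≤x₃c₂ ⟩
  x₃ * c₂ * c₁   ≡⟨ *ₚ.xy∙z≈xz∙y x₃ c₂ c₁ ⟩
  x₃ * c₁ * c₂   ∎)
  where open ≤-Reasoning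

argmax-ratio : ∀ {k} (x c : Fin k → ℕ) → (∀ t → 0 < c t) → Fin k →
            ∃ λ s → ∀ t → x t * c s ≤ x s * c t
argmax-ratio {zero}        x c c>0 ()
argmax-ratio {suc zero}    x c c>0 _ = zero , λ { zero → ≤-refl }
argmax-ratio {suc (suc k)} x c c>0 _
  with argmax-ratio (λ t → x (suc t)) (λ t → c (suc t)) (λ t → c>0 (suc t)) zero
... | s , s-max with x zero * c (suc s) ≤? x (suc s) * c zero
...   | yes x₀/c₀≤xₛ/cₛ = suc s , λ { zero → x₀/c₀≤xₛ/cₛ ; (suc t) → s-max t }
...   | no  x₀/c₀≰xₛ/cₛ = zero , λ { zero → ≤-refl
                                   ; (suc t) → ratio-≤-trans (x (suc t)) (c (suc t)) (x (suc s)) (c (suc s))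
                                                 (x zero) (c zero) {{>-nonZero (c>0 (suc s))}}
                                                 (s-max t) (<⇒≤ (≰⇒> x₀/c₀≰xₛ/cₛ)) }

module BipartiteGraph {p q : ℕ} (E : Fin p → Fin q → Bool) where

  Γ : (Fin p → Bool) → Fin q → Bool
  Γ X j = any p (λ i → X i ∧ E i j)

  Γ-mono : ∀ {X Y} → X ⊑ Y → Γ X ⊑ Γ Y
  Γ-mono X⊑Y j = any-mono p (λ i XiEij → let (Xi , Eij) = ∧-true⁻ XiEij in ∧-true⁺ (X⊑Y i Xi) Eij)

  Γ-cong : ∀ {X Y} → (∀ i → X i ≡ Y i) → ∀ j → Γ X j ≡ Γ Y j
  Γ-cong X≡Y j = any-cong p (λ i → cong (_∧ E i j) (X≡Y i))

  Γ-∪ : ∀ X Y j → Γ (X ∪ Y) j ≡ Γ X j ∨ Γ Y j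
  Γ-∪ X Y j = trans (any-cong p (λ i → Boolₚ.∧-distribʳ-∨ (E i j) (X i) (Y i)))
                    (any-∨ p (λ i → X i ∧ E i j) (λ i → Y i ∧ E i j))

  HallCondition : (Fin p → Bool) → (Fin q → Bool) → Set
  HallCondition L R = ∀ X → X ⊑ L → count p X ≤ count q (Γ X ∩ R)

  record Matching (L : Fin p → Bool) (R : Fin q → Bool) : Set where
    field
      match           : Fin p → Fin q
      match-into      : ∀ {i} → L i ≡ true → R (match i) ≡ true
      match-edge      : ∀ {i} → L i ≡ true → E i (match i) ≡ true
      match-injective : ∀ {i i′} → L i ≡ true → L i′ ≡ true → match i ≡ match i′ → i ≡ i′

  matching-empty : ∀ {L R} → Fin q → count p L ≡ 0 → Matching L R
  matching-empty {L} j₀ ∣L∣≡0 = record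
    { match           = λ _ → j₀
    ; match-into      = λ {i} → absurd i
    ; match-edge      = λ {i} → absurd i
    ; match-injective = λ {i} Li _ _ → absurd i Li
    }
    where
    absurd : ∀ i {A : Set} → L i ≡ true → A
    absurd i Li with () ← trans (sym Li) (count≡0⇒false p L ∣L∣≡0 i)

  matching-⁅⁆ : ∀ {R i₀ j₀} → R j₀ ≡ true → E i₀ j₀ ≡ true → Matching ⁅ i₀ ⁆ (R ∩ ⁅ j₀ ⁆)
  matching-⁅⁆ {R} {i₀} {j₀} Rj₀ Ei₀j₀ = record
    { match           = λ _ → j₀
    ; match-into      = λ _ → ∧-true⁺ Rj₀ ∈⁅ j₀ ⁆
    ; match-edge      = λ i₀≡i → subst (λ i → E i j₀ ≡ true) (∈⁅⁆⇒≡ i₀ i₀≡i) Ei₀j₀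
    ; match-injective = λ i₀≡i i₀≡i′ _ → trans (sym (∈⁅⁆⇒≡ i₀ i₀≡i)) (∈⁅⁆⇒≡ i₀ i₀≡i′)
    }

  -- The targets of the two matchings are separated by B, so the union stays injective.
  matching-glue : ∀ {L R X B} → Matching X (R ∩ B) → Matching (L ∖ X) (R ∖ B) → Matching L R
  matching-glue {L} {R} {X} {B} m₁ m₂ = record
    { match = match ; match-into = into ; match-edge = edge ; match-injective = injective }
    where
    module M₁ = Matching m₁
    module M₂ = Matching m₂

    match : Fin p → Fin q
    match i = if X i then M₁.match i else M₂.match i

    ∈L∖X : ∀ {i} → L i ≡ true → X i ≡ false → (L ∖ X) i ≡ true
    ∈L∖X Li Xi = ∧-true⁺ Li (cong not Xi)

    into : ∀ {i} → L i ≡ true → R (match i) ≡ true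
    into {i} Li with X i in Xi
    ... | true  = proj₁ (∧-true⁻ (M₁.match-into Xi))
    ... | false = proj₁ (∧-true⁻ (M₂.match-into (∈L∖X Li Xi)))

    edge : ∀ {i} → L i ≡ true → E i (match i) ≡ true
    edge {i} Li with X i in Xi
    ... | true  = M₁.match-edge Xi
    ... | false = M₂.match-edge (∈L∖X Li Xi)

    separated : ∀ {i i′} → X i ≡ true → (L ∖ X) i′ ≡ true → M₁.match i ≢ M₂.match i′
    separated Xi Li′ eq = true⇒not≢true (proj₂ (∧-true⁻ (M₁.match-into Xi)))
      (subst (λ j → not (B j) ≡ true) (sym eq) (proj₂ (∧-true⁻ (M₂.match-into Li′))))

    injective : ∀ {i i′} → L i ≡ true → L i′ ≡ true → match i ≡ match i′ → i ≡ i′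
    injective {i} {i′} Li Li′ eq with X i in Xi | X i′ in Xi′
    ... | true  | true  = M₁.match-injective Xi Xi′ eq
    ... | false | false = M₂.match-injective (∈L∖X Li Xi) (∈L∖X Li′ Xi′) eq
    ... | true  | false = ⊥-elim (separated Xi (∈L∖X Li′ Xi′) eq)
    ... | false | true  = ⊥-elim (separated Xi′ (∈L∖X Li Xi) (sym eq))

  Γ-⁅⁆ : ∀ {i j} → Γ ⁅ i ⁆ j ≡ true → E i j ≡ true
  Γ-⁅⁆ {i} {j} Γij with any⁻ p (λ i′ → ⁅ i ⁆ i′ ∧ E i′ j) Γij
  ... | i′ , i≡i′∧Ei′j with ∧-true⁻ i≡i′∧Ei′j
  ...   | i≡i′ , Ei′j = subst (λ i″ → E i″ j ≡ true) (sym (∈⁅⁆⇒≡ i i≡i′)) Ei′j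

  hall-neighbour : ∀ {L R i} → HallCondition L R → L i ≡ true →
                   ∃ λ j → R j ≡ true × E i j ≡ true
  hall-neighbour {L} {R} {i} hall Li =
    let j , Γij∧Rj = count>0⇒∃ q (Γ ⁅ i ⁆ ∩ R) ∣Γi∩R∣>0
        Γij , Rj   = ∧-true⁻ Γij∧Rj
    in j , Rj , Γ-⁅⁆ Γij
    where
    ∣Γi∩R∣>0 : 0 < count q (Γ ⁅ i ⁆ ∩ R)
    ∣Γi∩R∣>0 = subst (_≤ count q (Γ ⁅ i ⁆ ∩ R)) (count-⁅⁆ p i)
                 (hall ⁅ i ⁆ (⁅ i ⁆⊑ Li))

  hall-restrict : ∀ {L R X} → HallCondition L R → X ⊑ L → HallCondition X (R ∩ Γ X)
  hall-restrict {L} {R} {X} hall X⊑L Y Y⊑X =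
    subst (count p Y ≤_) (count-cong q (λ j → ∧-absorb (R j) (Γ-mono Y⊑X j)))
          (hall Y (λ i Yi → X⊑L i (Y⊑X i Yi)))
    where
    ∧-absorb : ∀ {x z} y → (x ≡ true → z ≡ true) → x ∧ y ≡ x ∧ (y ∧ z)
    ∧-absorb {false} y x⇒z = refl
    ∧-absorb {true}  y x⇒z rewrite x⇒z refl = sym (Boolₚ.∧-identityʳ y)

  -- Apply Hall's condition to Z ∪ X: as X is tight, X alone accounts for all of Γ X ∩ R.
  hall-contract : ∀ {L R X} → HallCondition L R → X ⊑ L → count q (Γ X ∩ R) ≤ count p X →
                  HallCondition (L ∖ X) (R ∖ Γ X)
  hall-contract {L} {R} {X} hall X⊑L tight Z Z⊑L∖X = +-cancelˡ-≤ (count p X) _ _ (begin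
    count p X + count p Z                         ≡⟨ sym ∣Z∪X∣ ⟩
    count p (Z ∪ X)                               ≤⟨ hall (Z ∪ X) Z∪X⊑L ⟩
    count q (Γ (Z ∪ X) ∩ R)                       ≡⟨ ∣Γ[Z∪X]∩R∣ ⟩
    count q (Γ X ∩ R) + count q (Γ Z ∩ (R ∖ Γ X)) ≤⟨ +-monoˡ-≤ _ tight ⟩
    count p X + count q (Γ Z ∩ (R ∖ Γ X))         ∎)
    where
    open ≤-Reasoning

    Z⇒¬X : ∀ i → Z i ≡ true → X i ≡ false
    Z⇒¬X i Zi with ∧-true⁻ (Z⊑L∖X i Zi)
    ... | _ , ¬Xi = Boolₚ.not-injective ¬Xi

    Z∪X⊑L : Z ∪ X ⊑ L
    Z∪X⊑L i Zi∨Xi with Z i in Zi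
    ... | true  = proj₁ (∧-true⁻ (Z⊑L∖X i Zi))
    ... | false = X⊑L i Zi∨Xi

    ∣Z∪X∣ : count p (Z ∪ X) ≡ count p X + count p Z
    ∣Z∪X∣ = trans (count-split p (Z ∪ X) X)
      (cong₂ _+_ (count-cong p (λ i → ∨-∧-absorb (Z i) (X i)))
                 (count-cong p (λ i → ∨-∧-not (Z⇒¬X i))))
      where
      ∨-∧-absorb : ∀ z x → (z ∨ x) ∧ x ≡ x
      ∨-∧-absorb z false = Boolₚ.∧-zeroʳ (z ∨ false)
      ∨-∧-absorb z true  = cong (_∧ true) (Boolₚ.∨-zeroʳ z)
      ∨-∧-not : ∀ {z x} → (z ≡ true → x ≡ false) → (z ∨ x) ∧ not x ≡ z
      ∨-∧-not {false} {false} _ = refl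
      ∨-∧-not {false} {true}  _ = refl
      ∨-∧-not {true}  z⇒¬x rewrite z⇒¬x refl = refl

    ∣Γ[Z∪X]∩R∣ : count q (Γ (Z ∪ X) ∩ R) ≡ count q (Γ X ∩ R) + count q (Γ Z ∩ (R ∖ Γ X))
    ∣Γ[Z∪X]∩R∣ = trans (count-split q (Γ (Z ∪ X) ∩ R) (Γ X))
      (cong₂ _+_ (count-cong q (λ j → trans (cong (λ b → (b ∧ R j) ∧ Γ X j) (Γ-∪ Z X j))
                                             (inside (Γ Z j) (Γ X j) (R j))))
                 (count-cong q (λ j → trans (cong (λ b → (b ∧ R j) ∧ not (Γ X j)) (Γ-∪ Z X j))
                                             (outside (Γ Z j) (Γ X j) (R j)))))
      where
      inside : ∀ z x r → ((z ∨ x) ∧ r) ∧ x ≡ x ∧ r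
      inside z     false r = Boolₚ.∧-zeroʳ _
      inside false true  r = Boolₚ.∧-identityʳ r
      inside true  true  r = Boolₚ.∧-identityʳ r
      outside : ∀ z x r → ((z ∨ x) ∧ r) ∧ not x ≡ z ∧ (r ∧ not x)
      outside z     true  r =
        trans (Boolₚ.∧-zeroʳ _) (sym (trans (cong (z ∧_) (Boolₚ.∧-zeroʳ r)) (Boolₚ.∧-zeroʳ z)))
      outside false false r = refl
      outside true  false r = refl

  Critical : (Fin p → Bool) → (Fin q → Bool) → (Fin p → Bool) → Set
  Critical L R X = X ⊑ L × 0 < count p X × count p X < count p L × count q (Γ X ∩ R) ≤ count p X

  critical? : ∀ L R X → Dec (Critical L R X)
  critical? L R X = all? (λ i → (X i Boolₚ.≟ true) →-dec (L i Boolₚ.≟ true))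
    ×-dec 0 <? count p X ×-dec count p X <? count p L ×-dec count q (Γ X ∩ R) ≤? count p X

  critical-cong : ∀ {L R X Y} → (∀ i → X i ≡ Y i) → Critical L R X → Critical L R Y
  critical-cong {L} {R} {X} {Y} X≡Y (X⊑L , ∣X∣>0 , ∣X∣<∣L∣ , tight) =
      (λ i Yi → X⊑L i (trans (X≡Y i) Yi))
    , subst (0 <_) ∣X∣≡∣Y∣ ∣X∣>0
    , subst (_< count p L) ∣X∣≡∣Y∣ ∣X∣<∣L∣
    , subst₂ _≤_ (count-cong q (λ j → cong (_∧ R j) (Γ-cong X≡Y j))) ∣X∣≡∣Y∣ tight
    where ∣X∣≡∣Y∣ = count-cong p X≡Y

  -- Without critical sets every nonempty Z ⊂ L has more than |Z| neighbours in R,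
  -- so it can afford to lose j₀.
  hall-delete : ∀ {L R i₀} j₀ → HallCondition L R → (∀ X → ¬ Critical L R X) → L i₀ ≡ true →
                HallCondition (L ∖ ⁅ i₀ ⁆) (R ∖ ⁅ j₀ ⁆)
  hall-delete {L} {R} {i₀} j₀ hall noCritical Li₀ Z Z⊑L∖i₀ with 0 <? count p Z
  ... | no  ∣Z∣≯0 = ≤-trans (≮⇒≥ ∣Z∣≯0) z≤n
  ... | yes ∣Z∣>0 = ≤-pred (begin-strict
    count p Z                                         <⟨ ≰⇒> not-tight ⟩
    count q (Γ Z ∩ R)                                 ≡⟨ count-split q (Γ Z ∩ R) ⁅ j₀ ⁆ ⟩
    count q (Γ Z ∩ R ∩ ⁅ j₀ ⁆) + count q (Γ Z ∩ R ∖ ⁅ j₀ ⁆) ≤⟨ +-mono-≤ ≤1 (≤-reflexive assoc) ⟩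
    1 + count q (Γ Z ∩ (R ∖ ⁅ j₀ ⁆))                  ∎)
    where
    open ≤-Reasoning
    Z⊑L : Z ⊑ L
    Z⊑L i Zi = proj₁ (∧-true⁻ (Z⊑L∖i₀ i Zi))
    ∣Z∣<∣L∣ : count p Z < count p L
    ∣Z∣<∣L∣ = ≤-trans (s≤s (count-mono p Z⊑L∖i₀)) (≤-reflexive (sym (count-∖⁅⁆ p Li₀)))
    not-tight : ¬ count q (Γ Z ∩ R) ≤ count p Z
    not-tight tight = noCritical Z (Z⊑L , ∣Z∣>0 , ∣Z∣<∣L∣ , tight)
    ≤1 : count q (Γ Z ∩ R ∩ ⁅ j₀ ⁆) ≤ 1
    ≤1 = subst (count q (Γ Z ∩ R ∩ ⁅ j₀ ⁆) ≤_) (count-⁅⁆ q j₀)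
            (count-mono q {Γ Z ∩ R ∩ ⁅ j₀ ⁆} (λ j w → proj₂ (∧-true⁻ w)))
    assoc : count q (Γ Z ∩ R ∖ ⁅ j₀ ⁆) ≡ count q (Γ Z ∩ (R ∖ ⁅ j₀ ⁆))
    assoc = count-cong q (λ j → Boolₚ.∧-assoc (Γ Z j) (R j) (not (⁅ j₀ ⁆ j)))

  HallUpTo : ℕ → Set
  HallUpTo c = ∀ L R → count p L ≤ c → HallCondition L R → Matching L R

  hall-critical : ∀ {c L R X} → HallUpTo c → count p L ≤ suc c → HallCondition L R →
                  Critical L R X → Matching L R
  hall-critical {c} {L} {R} {X} ih ∣L∣≤1+c hall (X⊑L , ∣X∣>0 , ∣X∣<∣L∣ , tight) =
    matching-glue (ih X (R ∩ Γ X) ∣X∣≤c (hall-restrict hall X⊑L))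
                  (ih (L ∖ X) (R ∖ Γ X) ∣L∖X∣≤c (hall-contract hall X⊑L tight))
    where
    ∣X∣≤c : count p X ≤ c
    ∣X∣≤c = ≤-pred (≤-trans ∣X∣<∣L∣ ∣L∣≤1+c)
    ∣L∖X∣≤c : count p (L ∖ X) ≤ c
    ∣L∖X∣≤c = ≤-pred (≤-trans (subst (count p (L ∖ X) <_) (sym (count-⊑-split p X⊑L))
                                     (m<n+m (count p (L ∖ X)) ∣X∣>0))
                              ∣L∣≤1+c)

  hall-uncritical : ∀ {c L R i₀} → HallUpTo c → count p L ≤ suc c → HallCondition L R →
                    (∀ X → ¬ Critical L R X) → L i₀ ≡ true → Matching L R
  hall-uncritical {c} {L} {R} {i₀} ih ∣L∣≤1+c hall noCritical Li₀ =
    let j₀ , Rj₀ , Ei₀j₀ = hall-neighbour hall Li₀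
    in matching-glue (matching-⁅⁆ Rj₀ Ei₀j₀)
                     (ih (L ∖ ⁅ i₀ ⁆) (R ∖ ⁅ j₀ ⁆) ∣L∖i₀∣≤c (hall-delete j₀ hall noCritical Li₀))
    where
    ∣L∖i₀∣≤c : count p (L ∖ ⁅ i₀ ⁆) ≤ c
    ∣L∖i₀∣≤c = ≤-pred (subst (_≤ suc c) (count-∖⁅⁆ p Li₀) ∣L∣≤1+c)

  hall-up-to : Fin q → ∀ c → HallUpTo c
  hall-up-to j₀ zero    L R ∣L∣≤0 hall = matching-empty j₀ (n≤0⇒n≡0 ∣L∣≤0)
  hall-up-to j₀ (suc c) L R ∣L∣≤1+c hall
    with anySubset? (λ v → critical? L R (lookup v)) | 0 <? count p L
  ... | yes (v , critical) | _ = hall-critical (hall-up-to j₀ c) ∣L∣≤1+c hall critical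
  ... | no ∄critical | no ∣L∣≯0 = matching-empty j₀ (n≤0⇒n≡0 (≮⇒≥ ∣L∣≯0))
  ... | no ∄critical | yes ∣L∣>0 =
    hall-uncritical (hall-up-to j₀ c) ∣L∣≤1+c hall
      (λ X critical → ∄critical (tabulate X , critical-cong (λ i → sym (lookup∘tabulate X i)) critical))
      (proj₂ (count>0⇒∃ p L ∣L∣>0))

  -- The target j₀ is a junk value for the vertices outside L.
  hall-theorem : Fin q → ∀ L R → HallCondition L R → Matching L R
  hall-theorem j₀ L R = hall-up-to j₀ (count p L) L R ≤-refl

  edges : (Fin p → Bool) → (Fin q → Bool) → ℕ
  edges Y Z = ∑ p (λ i → ∑ q (λ j → indicator (Y i ∧ Z j ∧ E i j)))

  LeftRegular : (Fin p → Bool) → (Fin q → Bool) → ℕ → Set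
  LeftRegular A B u = ∀ i → A i ≡ true → count q (λ j → B j ∧ E i j) ≡ u

  RightRegular : (Fin p → Bool) → (Fin q → Bool) → ℕ → Set
  RightRegular A B w = ∀ j → B j ≡ true → count p (λ i → A i ∧ E i j) ≡ w

  edges-left-regular : ∀ {A B Y u} → LeftRegular A B u → Y ⊑ A → edges Y B ≡ count p Y * u
  edges-left-regular {A} {B} {Y} {u} regular Y⊑A =
    trans (∑-cong p row) (sym (*-distribʳ-∑ p u (λ i → indicator (Y i))))
    where
    row : ∀ i → ∑ q (λ j → indicator (Y i ∧ B j ∧ E i j)) ≡ indicator (Y i) * u
    row i with Y i in Yi
    ... | true  = trans (regular i (Y⊑A i Yi)) (sym (+-identityʳ u))
    ... | false = ∑-zero q

  edges-right-regular : ∀ {A B w} → RightRegular A B w → edges A B ≡ count q B * w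
  edges-right-regular {A} {B} {w} regular =
    trans (∑-comm p q _) (trans (∑-cong q column) (sym (*-distribʳ-∑ q w (λ j → indicator (B j)))))
    where
    column : ∀ j → ∑ p (λ i → indicator (A i ∧ B j ∧ E i j)) ≡ indicator (B j) * w
    column j with B j in Bj
    ... | true  = trans (regular j Bj) (sym (+-identityʳ w))
    ... | false = trans (count-cong p (λ i → Boolₚ.∧-zeroʳ (A i))) (∑-zero p)

  edges-≤-Γ : ∀ {A B Y w} → RightRegular A B w → Y ⊑ A → edges Y B ≤ count q (Γ Y ∩ B) * w
  edges-≤-Γ {A} {B} {Y} {w} regular Y⊑A = begin
    edges Y B                                            ≡⟨ ∑-comm p q _ ⟩
    ∑ q (λ j → ∑ p (λ i → indicator (Y i ∧ B j ∧ E i j))) ≤⟨ ∑-mono-≤ q column ⟩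
    ∑ q (λ j → indicator ((Γ Y ∩ B) j) * w)              ≡⟨ *-distribʳ-∑ q w _ ⟨
    count q (Γ Y ∩ B) * w                                ∎
    where
    open ≤-Reasoning
    none : ∀ {X : Fin p → Bool} {m} → (∀ i → X i ≡ false) → count p X ≤ m
    none X≡false = ≤-trans (≤-reflexive (trans (count-cong p X≡false) (∑-zero p))) z≤n
    column : ∀ j → ∑ p (λ i → indicator (Y i ∧ B j ∧ E i j)) ≤ indicator (Γ Y j ∧ B j) * w
    column j with B j in Bj | Γ Y j in ΓYj
    ... | false | _     = none (λ i → Boolₚ.∧-zeroʳ (Y i))
    ... | true  | false = none (any-false p (λ i → Y i ∧ E i j) ΓYj)
    ... | true  | true  = begin
      count p (λ i → Y i ∧ E i j) ≤⟨ count-mono p (λ i YiEij → let Yi , Eij = ∧-true⁻ YiEij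
                                                                  in ∧-true⁺ (Y⊑A i Yi) Eij) ⟩
      count p (λ i → A i ∧ E i j) ≡⟨ regular j Bj ⟩
      w                           ≡⟨ +-identityʳ w ⟨
      1 * w                       ∎

  NormalizedMatching : (Fin p → Bool) → (Fin q → Bool) → Set
  NormalizedMatching A B = ∀ Y → Y ⊑ A → count p Y * count q B ≤ count q (Γ Y ∩ B) * count p A

  -- Double counting the edges between A and B gives |A| u = |B| w,
  -- and between Y and B gives |Y| u ≤ |Γ Y ∩ B| w.
  biregular⇒normalized : ∀ {A B u w} .{{_ : NonZero w}} →
                         LeftRegular A B u → RightRegular A B w → NormalizedMatching A B
  biregular⇒normalized {A} {B} {u} {w} left right Y Y⊑A = *-cancelʳ-≤ _ _ w (begin
    y * b * w   ≡⟨ *-assoc y b w ⟩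
    y * (b * w) ≡⟨ cong (y *_) handshake ⟩
    y * (a * u) ≡⟨ *ₚ.x∙yz≈y∙xz y a u ⟩
    a * (y * u) ≡⟨ cong (a *_) (edges-left-regular left Y⊑A) ⟨
    a * edges Y B ≤⟨ *-monoʳ-≤ a (edges-≤-Γ right Y⊑A) ⟩
    a * (z * w) ≡⟨ *ₚ.x∙yz≈yx∙z a z w ⟩
    z * a * w   ∎)
    where
    open ≤-Reasoning
    a = count p A
    b = count q B
    y = count p Y
    z = count q (Γ Y ∩ B)
    handshake : b * w ≡ a * u
    handshake = trans (sym (edges-right-regular right)) (edges-left-regular left (λ _ Ai → Ai))

  module Levels {k m} (rankˡ : Fin p → ℕ) (rankʳ : Fin q → ℕ) (a : Fin k → ℕ) (b : Fin m → ℕ) where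

    A : Fin k → Fin p → Bool
    A t = level rankˡ (a t)

    B : Fin m → Fin q → Bool
    B s = level rankʳ (b s)

    hall-via-densest-level :
      Injective _≡_ _≡_ a → Injective _≡_ _≡_ b →
      ∑ k (λ u → count p (A u)) ≤ ∑ m (λ s → count q (B s)) →
      ∀ X → X ⊑ levels rankˡ a → ∀ t → 0 < count p (A t) → (∀ s → NormalizedMatching (A t) (B s)) →
      (∀ u → count p (X ∩ A u) * count p (A t) ≤ count p (X ∩ A t) * count p (A u)) →
      count p X ≤ count q (Γ X ∩ levels rankʳ b)
    hall-via-densest-level a-inj b-inj ∑A≤∑B X X⊑L t ∣At∣>0 normalized densest =
      *-cancelˡ-≤ α {{>-nonZero ∣At∣>0}} (begin
        α * count p X                    ≡⟨ cong (α *_) (count-levels rankˡ a a-inj X X⊑L) ⟩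
        α * ∑ k x                        ≡⟨ *-distribˡ-∑ k α x ⟩
        ∑ k (λ u → α * x u)              ≤⟨ ∑-mono-≤ k (λ u → subst (_≤ x* * count p (A u)) (*-comm (x u) α) (densest u)) ⟩
        ∑ k (λ u → x* * count p (A u))   ≡⟨ *-distribˡ-∑ k x* _ ⟨
        x* * ∑ k (λ u → count p (A u))   ≤⟨ *-monoʳ-≤ x* ∑A≤∑B ⟩
        x* * ∑ m (λ s → count q (B s))   ≡⟨ *-distribˡ-∑ m x* _ ⟩
        ∑ m (λ s → x* * count q (B s))   ≤⟨ ∑-mono-≤ m neighbours-in ⟩
        ∑ m (λ s → α * count q (ΓX∩R ∩ B s)) ≡⟨ *-distribˡ-∑ m α _ ⟨
        α * ∑ m (λ s → count q (ΓX∩R ∩ B s)) ≡⟨ cong (α *_) (count-levels rankʳ b b-inj ΓX∩R ΓX∩R⊑R) ⟨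
        α * count q ΓX∩R                 ∎)
      where
      open ≤-Reasoning
      α = count p (A t)
      x : Fin k → ℕ
      x u = count p (X ∩ A u)
      x* = x t
      ΓX∩R = Γ X ∩ levels rankʳ b
      ΓX∩R⊑R : ΓX∩R ⊑ levels rankʳ b
      ΓX∩R⊑R j w = proj₂ (∧-true⁻ w)
      neighbours-in : ∀ s → x* * count q (B s) ≤ α * count q (ΓX∩R ∩ B s)
      neighbours-in s = begin
        x* * count q (B s)                  ≤⟨ normalized s (X ∩ A t) (λ i w → proj₂ (∧-true⁻ w)) ⟩
        count q (Γ (X ∩ A t) ∩ B s) * α     ≤⟨ *-monoˡ-≤ α (count-mono q ΓXₜ∩Bₛ⊑ΓX∩R∩Bₛ) ⟩
        count q (ΓX∩R ∩ B s) * α            ≡⟨ *-comm _ α ⟩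
        α * count q (ΓX∩R ∩ B s)            ∎
        where
        ΓXₜ∩Bₛ⊑ΓX∩R∩Bₛ : Γ (X ∩ A t) ∩ B s ⊑ ΓX∩R ∩ B s
        ΓXₜ∩Bₛ⊑ΓX∩R∩Bₛ j w = let ΓXₜj , Bsj = ∧-true⁻ w in
          ∧-true⁺ (∧-true⁺ (Γ-mono (λ i w′ → proj₁ (∧-true⁻ w′)) j ΓXₜj)
                           (levels⁺ rankʳ b s (≡ᵇ-true⁻ Bsj)))
                  Bsj

    hall-for-levels :
      Injective _≡_ _≡_ a → Injective _≡_ _≡_ b →
      ∑ k (λ t → count p (A t)) ≤ ∑ m (λ s → count q (B s)) →
      (∀ t → 0 < count p (A t)) → (∀ t s → NormalizedMatching (A t) (B s)) →
      HallCondition (levels rankˡ a) (levels rankʳ b)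
    hall-for-levels a-inj b-inj ∑A≤∑B ∣A∣>0 normalized X X⊑L with 0 <? count p X
    ... | no  ∣X∣≯0 = ≤-trans (≮⇒≥ ∣X∣≯0) z≤n
    ... | yes ∣X∣>0 =
      let i , Xi = count>0⇒∃ p X ∣X∣>0
          t₀ , _ = levels⁻ rankˡ a (X⊑L i Xi)
          t , densest = argmax-ratio (λ u → count p (X ∩ A u)) (λ u → count p (A u)) ∣A∣>0 t₀
      in hall-via-densest-level a-inj b-inj ∑A≤∑B X X⊑L t (∣A∣>0 t) (normalized t) densest

C-pos : ∀ {n k} → k ≤ n → 0 < n C k
C-pos {n}     {zero}  _         = z<s
C-pos {suc n} {suc k} (s≤s k≤n) =
  <-≤-trans (C-pos k≤n) (≤-trans (m≤m+n (n C k) _) (≤-reflexive (nCk+nC[k+1]≡[n+1]C[k+1] n k)))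

_⊆ᵇ_ : ∀ {n} → Subset n → Subset n → Bool
[]      ⊆ᵇ []      = true
(x ∷ S) ⊆ᵇ (y ∷ T) = (not x ∨ y) ∧ (S ⊆ᵇ T)

⊆ᵇ⇒⊆ : ∀ {n} (S T : Subset n) → S ⊆ᵇ T ≡ true → S ⊆ T
⊆ᵇ⇒⊆ (x ∷ S) (true  ∷ T) _   here      = here
⊆ᵇ⇒⊆ (x ∷ S) (y     ∷ T) S⊆T (there i) = there (⊆ᵇ⇒⊆ S T (proj₂ (∧-true⁻ {not x ∨ y} S⊆T)) i)

-- Subsets of [n] are enumerated by Fin (2 ^ n); those containing the first element come first.
encode : ∀ {n} → Subset n → Fin (2 ^ n)
encode {zero}  []          = zero
encode {suc n} (true  ∷ S) = encode S ↑ˡ (2 ^ n + 0)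
encode {suc n} (false ∷ S) = 2 ^ n ↑ʳ (encode S ↑ˡ 0)

decode : ∀ {n} → Fin (2 ^ n) → Subset n
decode {zero}  _ = []
decode {suc n} i = [ (λ j → true ∷ decode j)
                   , (λ j → [ (λ j′ → false ∷ decode j′) , (λ ()) ]′ (splitAt (2 ^ n) j)) ]′
                   (splitAt (2 ^ n) i)

decode-true : ∀ {n} (j : Fin (2 ^ n)) → decode {suc n} (j ↑ˡ (2 ^ n + 0)) ≡ true ∷ decode j
decode-true {n} j rewrite splitAt-↑ˡ (2 ^ n) j (2 ^ n + 0) = refl

decode-false : ∀ {n} (j : Fin (2 ^ n)) → decode {suc n} (2 ^ n ↑ʳ (j ↑ˡ 0)) ≡ false ∷ decode j
decode-false {n} j rewrite splitAt-↑ʳ (2 ^ n) (2 ^ n + 0) (j ↑ˡ 0) | splitAt-↑ˡ (2 ^ n) j 0 = refl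

decode-encode : ∀ {n} (S : Subset n) → decode (encode S) ≡ S
decode-encode {zero}  []          = refl
decode-encode {suc n} (true  ∷ S) = trans (decode-true (encode S)) (cong (true ∷_) (decode-encode S))
decode-encode {suc n} (false ∷ S) = trans (decode-false (encode S)) (cong (false ∷_) (decode-encode S))

encode-decode : ∀ {n} (i : Fin (2 ^ n)) → encode {n} (decode i) ≡ i
encode-decode {zero}  zero = refl
encode-decode {suc n} i with splitAt (2 ^ n) i in split-i
... | inj₁ j = begin
  encode {n} (decode j) ↑ˡ (2 ^ n + 0)               ≡⟨ cong (_↑ˡ (2 ^ n + 0)) (encode-decode {n} j) ⟩
  join (2 ^ n) (2 ^ n + 0) (inj₁ j)                  ≡⟨ cong (join (2 ^ n) (2 ^ n + 0)) split-i ⟨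
  join (2 ^ n) (2 ^ n + 0) (splitAt (2 ^ n) i)       ≡⟨ join-splitAt (2 ^ n) (2 ^ n + 0) i ⟩
  i                                                  ∎
  where open ≡-Reasoning
... | inj₂ j with splitAt (2 ^ n) {0} j in split-j
...   | inj₁ j′ = begin
  2 ^ n ↑ʳ (encode {n} (decode j′) ↑ˡ 0)              ≡⟨ cong (λ j″ → 2 ^ n ↑ʳ (j″ ↑ˡ 0)) (encode-decode {n} j′) ⟩
  2 ^ n ↑ʳ join (2 ^ n) 0 (inj₁ j′)                   ≡⟨ cong (λ s → 2 ^ n ↑ʳ join (2 ^ n) 0 s) split-j ⟨
  2 ^ n ↑ʳ join (2 ^ n) 0 (splitAt (2 ^ n) j)         ≡⟨ cong (2 ^ n ↑ʳ_) (join-splitAt (2 ^ n) 0 j) ⟩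
  join (2 ^ n) (2 ^ n + 0) (inj₂ j)                   ≡⟨ cong (join (2 ^ n) (2 ^ n + 0)) split-i ⟨
  join (2 ^ n) (2 ^ n + 0) (splitAt (2 ^ n) i)        ≡⟨ join-splitAt (2 ^ n) (2 ^ n + 0) i ⟩
  i                                                   ∎
  where open ≡-Reasoning

∑ₛ : ∀ n → (Subset n → ℕ) → ℕ
∑ₛ zero    h = h []
∑ₛ (suc n) h = ∑ₛ n (λ T → h (true ∷ T)) + ∑ₛ n (λ T → h (false ∷ T))

∑ₛ-cong : ∀ n {g h : Subset n → ℕ} → (∀ T → g T ≡ h T) → ∑ₛ n g ≡ ∑ₛ n h
∑ₛ-cong zero    g≡h = g≡h []
∑ₛ-cong (suc n) g≡h = cong₂ _+_ (∑ₛ-cong n (λ T → g≡h (true ∷ T))) (∑ₛ-cong n (λ T → g≡h (false ∷ T)))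

∑ₛ-zero : ∀ n → ∑ₛ n (λ _ → 0) ≡ 0
∑ₛ-zero zero    = refl
∑ₛ-zero (suc n) = cong₂ _+_ (∑ₛ-zero n) (∑ₛ-zero n)

∑-decode : ∀ n (h : Subset n → ℕ) → ∑ (2 ^ n) (λ i → h (decode i)) ≡ ∑ₛ n h
∑-decode zero    h = +-identityʳ (h [])
∑-decode (suc n) h =
  trans (∑-++ (2 ^ n) (2 ^ n + 0) (λ i → h (decode i))) (cong₂ _+_ true-half false-half)
  where
  true-half : ∑ (2 ^ n) (λ j → h (decode (j ↑ˡ (2 ^ n + 0)))) ≡ ∑ₛ n (λ T → h (true ∷ T))
  true-half = trans (∑-cong (2 ^ n) (λ j → cong h (decode-true j))) (∑-decode n (λ T → h (true ∷ T)))
  false-half : ∑ (2 ^ n + 0) (λ j → h (decode (2 ^ n ↑ʳ j))) ≡ ∑ₛ n (λ T → h (false ∷ T))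
  false-half = begin
    ∑ (2 ^ n + 0) (λ j → h (decode (2 ^ n ↑ʳ j)))            ≡⟨ ∑-++ (2 ^ n) 0 _ ⟩
    ∑ (2 ^ n) (λ j → h (decode (2 ^ n ↑ʳ (j ↑ˡ 0)))) + 0     ≡⟨ +-identityʳ _ ⟩
    ∑ (2 ^ n) (λ j → h (decode (2 ^ n ↑ʳ (j ↑ˡ 0))))         ≡⟨ ∑-cong (2 ^ n) (λ j → cong h (decode-false j)) ⟩
    ∑ (2 ^ n) (λ j → h (false ∷ decode j))                   ≡⟨ ∑-decode n (λ T → h (false ∷ T)) ⟩
    ∑ₛ n (λ T → h (false ∷ T))                               ∎
    where open ≡-Reasoning

∑ₛ-level : ∀ n c → ∑ₛ n (λ T → indicator (∣ T ∣ ≡ᵇ c)) ≡ n C c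
∑ₛ-level zero    zero    = refl
∑ₛ-level zero    (suc c) = refl
∑ₛ-level (suc n) zero    = cong₂ _+_ (∑ₛ-zero n) (∑ₛ-level n zero)
∑ₛ-level (suc n) (suc c) =
  trans (cong₂ _+_ (∑ₛ-level n c) (∑ₛ-level n (suc c))) (nCk+nC[k+1]≡[n+1]C[k+1] n c)

∑ₛ-subsets : ∀ {n} (S : Subset n) c → ∑ₛ n (λ T → indicator ((∣ T ∣ ≡ᵇ c) ∧ T ⊆ᵇ S)) ≡ ∣ S ∣ C c
∑ₛ-subsets []          zero    = refl
∑ₛ-subsets []          (suc c) = refl
∑ₛ-subsets {suc n} (false ∷ S) c = begin
  ∑ₛ n (λ T → indicator ((suc ∣ T ∣ ≡ᵇ c) ∧ false)) + ∑ₛ n (λ T → indicator ((∣ T ∣ ≡ᵇ c) ∧ T ⊆ᵇ S))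
    ≡⟨ cong₂ _+_ (trans (∑ₛ-cong n (λ T → cong indicator (Boolₚ.∧-zeroʳ _))) (∑ₛ-zero n))
                 (∑ₛ-subsets S c) ⟩
  ∣ S ∣ C c ∎
  where open ≡-Reasoning
∑ₛ-subsets {suc n} (true ∷ S) zero    = cong₂ _+_ (∑ₛ-zero n) (∑ₛ-subsets S zero)
∑ₛ-subsets {suc n} (true ∷ S) (suc c) =
  trans (cong₂ _+_ (∑ₛ-subsets S c) (∑ₛ-subsets S (suc c))) (nCk+nC[k+1]≡[n+1]C[k+1] ∣ S ∣ c)

∑ₛ-supersets : ∀ {n} (S : Subset n) c →
               ∑ₛ n (λ T → indicator ((∣ T ∣ ≡ᵇ ∣ S ∣ + c) ∧ S ⊆ᵇ T)) ≡ ∣ ∁ S ∣ C c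
∑ₛ-supersets []          zero    = refl
∑ₛ-supersets []          (suc c) = refl
∑ₛ-supersets {suc n} (true ∷ S) c =
  trans (cong₂ _+_ (∑ₛ-supersets S c)
                   (trans (∑ₛ-cong n (λ T → cong indicator (Boolₚ.∧-zeroʳ _))) (∑ₛ-zero n)))
        (+-identityʳ _)
∑ₛ-supersets {suc n} (false ∷ S) zero =
  cong₂ _+_ (trans (∑ₛ-cong n (λ T → cong indicator (too-large T))) (∑ₛ-zero n))
            (∑ₛ-supersets S zero)
  where
  too-large : ∀ T → (suc ∣ T ∣ ≡ᵇ ∣ S ∣ + 0) ∧ S ⊆ᵇ T ≡ false
  too-large T with S ⊆ᵇ T in S⊆T
  ... | false = Boolₚ.∧-zeroʳ _
  ... | true  = trans (Boolₚ.∧-identityʳ _) (≡ᵇ-false⁺ (λ eq → <-irrefl (sym eq)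
                  (s≤s (≤-trans (≤-reflexive (+-identityʳ ∣ S ∣)) (p⊆q⇒∣p∣≤∣q∣ (⊆ᵇ⇒⊆ S T S⊆T))))))
∑ₛ-supersets {suc n} (false ∷ S) (suc c) =
  trans (cong₂ _+_ (trans (∑ₛ-cong n (λ T → cong (λ s → indicator ((suc ∣ T ∣ ≡ᵇ s) ∧ S ⊆ᵇ T)) (+-suc ∣ S ∣ c)))
                          (∑ₛ-supersets S c))
                   (∑ₛ-supersets S (suc c)))
        (nCk+nC[k+1]≡[n+1]C[k+1] ∣ ∁ S ∣ c)

∑ₛ-supersets-of-size : ∀ {n} (S : Subset n) {β} → ∣ S ∣ ≤ β →
                       ∑ₛ n (λ T → indicator ((∣ T ∣ ≡ᵇ β) ∧ S ⊆ᵇ T)) ≡ (n ∸ ∣ S ∣) C (β ∸ ∣ S ∣)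
∑ₛ-supersets-of-size {n} S {β} ∣S∣≤β = begin
  ∑ₛ n (λ T → indicator ((∣ T ∣ ≡ᵇ β) ∧ S ⊆ᵇ T))
    ≡⟨ ∑ₛ-cong n (λ T → cong (λ γ → indicator ((∣ T ∣ ≡ᵇ γ) ∧ S ⊆ᵇ T)) (sym (m+[n∸m]≡n ∣S∣≤β))) ⟩
  ∑ₛ n (λ T → indicator ((∣ T ∣ ≡ᵇ ∣ S ∣ + (β ∸ ∣ S ∣)) ∧ S ⊆ᵇ T))
    ≡⟨ ∑ₛ-supersets S (β ∸ ∣ S ∣) ⟩
  ∣ ∁ S ∣ C (β ∸ ∣ S ∣)
    ≡⟨ cong (_C (β ∸ ∣ S ∣)) (∣∁p∣≡n∸∣p∣ S) ⟩
  (n ∸ ∣ S ∣) C (β ∸ ∣ S ∣) ∎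
  where open ≡-Reasoning

module BooleanLattice (n : ℕ) where

  size : Fin (2 ^ n) → ℕ
  size i = ∣ decode {n} i ∣

  -- Comparing sizes first decides which inclusion to test, which makes the degrees easy to count.
  comparable : Subset n → Subset n → Bool
  comparable S T = if ∣ S ∣ ≤ᵇ ∣ T ∣ then S ⊆ᵇ T else T ⊆ᵇ S

  comparable⇒⊆⊎⊇ : ∀ S T → comparable S T ≡ true → S ⊆ T ⊎ T ⊆ S
  comparable⇒⊆⊎⊇ S T S~T with ∣ S ∣ ≤ᵇ ∣ T ∣
  ... | true  = inj₁ (⊆ᵇ⇒⊆ S T S~T)
  ... | false = inj₂ (⊆ᵇ⇒⊆ T S S~T)

  comparable-sizes : ∀ S T {α β b} → ∣ S ∣ ≡ α → ∣ T ∣ ≡ β → (α ≤ᵇ β) ≡ b →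
                     comparable S T ≡ (if b then S ⊆ᵇ T else T ⊆ᵇ S)
  comparable-sizes S T refl refl α≤ᵇβ = cong (λ b → if b then S ⊆ᵇ T else T ⊆ᵇ S) α≤ᵇβ

  open BipartiteGraph (λ i j → comparable (decode {n} i) (decode j)) public

  degreeˡ degreeʳ : ℕ → ℕ → ℕ
  degreeˡ α β = if α ≤ᵇ β then (n ∸ α) C (β ∸ α) else α C β
  degreeʳ α β = if α ≤ᵇ β then β C α else (n ∸ β) C (α ∸ β)

  -- The case splits on the size test go through an equation: a plain 'with' would also
  -- abstract the identical test inside the definition of _C_.
  ∑ₛ-degreeˡ : ∀ S β → ∑ₛ n (λ T → indicator ((∣ T ∣ ≡ᵇ β) ∧ comparable S T)) ≡ degreeˡ ∣ S ∣ β
  ∑ₛ-degreeˡ S β = split refl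
    where
    restrict : ∀ {b} → (∣ S ∣ ≤ᵇ β) ≡ b →
               ∑ₛ n (λ T → indicator ((∣ T ∣ ≡ᵇ β) ∧ comparable S T)) ≡
               ∑ₛ n (λ T → indicator ((∣ T ∣ ≡ᵇ β) ∧ (if b then S ⊆ᵇ T else T ⊆ᵇ S)))
    restrict α≤ᵇβ = ∑ₛ-cong n (λ T → cong indicator (∧-cong-guard (λ ∣T∣≡ᵇβ →
      comparable-sizes S T refl (≡ᵇ-true⁻ {∣ T ∣} ∣T∣≡ᵇβ) α≤ᵇβ)))
    split : ∀ {b} → (∣ S ∣ ≤ᵇ β) ≡ b → ∑ₛ n (λ T → indicator ((∣ T ∣ ≡ᵇ β) ∧ comparable S T)) ≡
                                       (if b then (n ∸ ∣ S ∣) C (β ∸ ∣ S ∣) else ∣ S ∣ C β)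
    split {true}  α≤ᵇβ = trans (restrict α≤ᵇβ) (∑ₛ-supersets-of-size S (≤ᵇ-true⁻ {∣ S ∣} α≤ᵇβ))
    split {false} α≤ᵇβ = trans (restrict α≤ᵇβ) (∑ₛ-subsets S β)

  ∑ₛ-degreeʳ : ∀ α T → ∑ₛ n (λ S → indicator ((∣ S ∣ ≡ᵇ α) ∧ comparable S T)) ≡ degreeʳ α ∣ T ∣
  ∑ₛ-degreeʳ α T = split refl
    where
    restrict : ∀ {b} → (α ≤ᵇ ∣ T ∣) ≡ b →
               ∑ₛ n (λ S → indicator ((∣ S ∣ ≡ᵇ α) ∧ comparable S T)) ≡
               ∑ₛ n (λ S → indicator ((∣ S ∣ ≡ᵇ α) ∧ (if b then S ⊆ᵇ T else T ⊆ᵇ S)))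
    restrict α≤ᵇβ = ∑ₛ-cong n (λ S → cong indicator (∧-cong-guard (λ ∣S∣≡ᵇα →
      comparable-sizes S T (≡ᵇ-true⁻ {∣ S ∣} ∣S∣≡ᵇα) refl α≤ᵇβ)))
    split : ∀ {b} → (α ≤ᵇ ∣ T ∣) ≡ b → ∑ₛ n (λ S → indicator ((∣ S ∣ ≡ᵇ α) ∧ comparable S T)) ≡
                                       (if b then ∣ T ∣ C α else (n ∸ ∣ T ∣) C (α ∸ ∣ T ∣))
    split {true}  α≤ᵇβ = trans (restrict α≤ᵇβ) (∑ₛ-subsets T α)
    split {false} α≤ᵇβ = trans (restrict α≤ᵇβ) (∑ₛ-supersets-of-size T (<⇒≤ (≤ᵇ-false⁻ {α} α≤ᵇβ)))

  degreeʳ-pos : ∀ {α β} → α ≤ n → 0 < degreeʳ α β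
  degreeʳ-pos {α} {β} α≤n = split refl
    where
    split : ∀ {b} → (α ≤ᵇ β) ≡ b → 0 < (if b then β C α else (n ∸ β) C (α ∸ β))
    split {true}  α≤ᵇβ = C-pos (≤ᵇ-true⁻ {α} α≤ᵇβ)
    split {false} _    = C-pos {n ∸ β} (∸-monoˡ-≤ β α≤n)

  count-level : ∀ c → count (2 ^ n) (level size c) ≡ n C c
  count-level c = trans (∑-decode n (λ T → indicator (∣ T ∣ ≡ᵇ c))) (∑ₛ-level n c)

  levels-normalized : ∀ {α} β → α ≤ n → NormalizedMatching (level size α) (level size β)
  levels-normalized {α} β α≤n = biregular⇒normalized {{>-nonZero (degreeʳ-pos {α} {β} α≤n)}} left right
    where
    left : LeftRegular (level size α) (level size β) (degreeˡ α β)
    left i ∣i∣≡α = trans (∑-decode n _) (trans (∑ₛ-degreeˡ (decode {n} i) β)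
                                               (cong (λ γ → degreeˡ γ β) (≡ᵇ-true⁻ {size i} ∣i∣≡α)))
    right : RightRegular (level size α) (level size β) (degreeʳ α β)
    right j ∣j∣≡β = trans (∑-decode n _) (trans (∑ₛ-degreeʳ α (decode {n} j))
                                                (cong (degreeʳ α) (≡ᵇ-true⁻ {size j} ∣j∣≡β)))

  module FromMatching {k m} (a : Fin k → ℕ) (b : Fin m → ℕ)
                      (M : Matching (levels size a) (levels size b)) where

    open Matching M

    Φ : Subset n → Subset n
    Φ S = decode (match (encode S))

    encode-∈ : ∀ {S : Subset n} → HasSizeIn a S → levels size a (encode S) ≡ true
    encode-∈ {S} (t , ∣S∣≡at) = levels⁺ size a t (trans (cong ∣_∣ (decode-encode S)) ∣S∣≡at)

    Φ-size : ∀ {S : Subset n} → HasSizeIn a S → HasSizeIn b (Φ S)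
    Φ-size S∈ = levels⁻ size b (match-into (encode-∈ S∈))

    Φ-comparable : ∀ {S : Subset n} → HasSizeIn a S → (S ⊆ Φ S) ⊎ (Φ S ⊆ S)
    Φ-comparable {S} S∈ = comparable⇒⊆⊎⊇ S (Φ S)
      (subst (λ S′ → comparable S′ (Φ S) ≡ true) (decode-encode S) (match-edge (encode-∈ S∈)))

    Φ-injective : ∀ (S S′ : Subset n) → HasSizeIn a S → HasSizeIn a S′ → Φ S ≡ Φ S′ → S ≡ S′
    Φ-injective S S′ S∈ S′∈ ΦS≡ΦS′ = begin
      S                  ≡⟨ decode-encode S ⟨
      decode (encode S)  ≡⟨ cong decode (match-injective (encode-∈ S∈) (encode-∈ S′∈) match≡) ⟩
      decode (encode S′) ≡⟨ decode-encode S′ ⟩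
      S′                 ∎
      where
      open ≡-Reasoning
      match≡ : match (encode S) ≡ match (encode S′)
      match≡ = trans (sym (encode-decode {n} (match (encode S))))
                     (trans (cong encode ΦS≡ΦS′) (encode-decode {n} (match (encode S′))))

strictlyIncreasing⇒injective : ∀ {k} {a : Fin k → ℕ} → StrictlyIncreasing a → Injective _≡_ _≡_ a
strictlyIncreasing⇒injective {a = a} a-inc {t} {t′} at≡at′ with <-cmpᶠ t t′
... | tri< t<t′ _ _ = ⊥-elim (<-irrefl at≡at′ (a-inc t t′ t<t′))
... | tri≈ _ t≡t′ _ = t≡t′
... | tri> _ _ t′<t = ⊥-elim (<-irrefl (sym at≡at′) (a-inc t′ t t′<t))

corollary5p1 : (n k m : ℕ) (a : Fin k → ℕ) (b : Fin m → ℕ) →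
    StrictlyIncreasing a → BoundedBy n a →
    StrictlyIncreasing b → BoundedBy n b →
    ∑ k (λ i → n C a i) ≤ ∑ m (λ j → n C b j) →
    Σ (Subset n → Subset n) λ Φ →
      (∀ (S : Subset n) → HasSizeIn a S →
         HasSizeIn b (Φ S) × ((S ⊆ Φ S) ⊎ (Φ S ⊆ S)))
      × (∀ (S S′ : Subset n) → HasSizeIn a S → HasSizeIn a S′ →
           Φ S ≡ Φ S′ → S ≡ S′)
corollary5p1 n k m a b a-inc a≤n b-inc b≤n ∑a≤∑b =
  Φ , (λ S S∈ → Φ-size S∈ , Φ-comparable S∈) , Φ-injective
  where
  open BooleanLattice n
  open Levels size size a b

  ∑A≤∑B : ∑ k (λ t → count (2 ^ n) (A t)) ≤ ∑ m (λ s → count (2 ^ n) (B s))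
  ∑A≤∑B = subst₂ _≤_ (∑-cong k (λ t → sym (count-level (a t))))
                     (∑-cong m (λ s → sym (count-level (b s)))) ∑a≤∑b

  matching : Matching (levels size a) (levels size b)
  matching = hall-theorem (encode {n} ⊥) (levels size a) (levels size b)
    (hall-for-levels (strictlyIncreasing⇒injective a-inc) (strictlyIncreasing⇒injective b-inc) ∑A≤∑B
      (λ t → subst (0 <_) (sym (count-level (a t))) (C-pos (a≤n t)))
      (λ t s → levels-normalized (b s) (a≤n t)))

  open FromMatching a b matching
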